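{- Let $(C,\alpha)$ be a $\mathcal{T}$-coalgebra and $c\in C$. (i) If $r\in\mathrm{Roots}(\alpha,c)$ and $s\in\mathrm{Roots}(\alpha,\mathrm{sub}^\alpha(c,r))$, then $rs\in\mathrm{Roots}(\alpha,c)$, $\mathrm{frag}^\alpha(\mathrm{sub}^\alpha(c,r),s)=\mathrm{frag}^\alpha(c,rs)$ and $\mathrm{sub}^\alpha(\mathrm{sub}^\alpha(c,r),s)=\mathrm{sub}^\alpha(c,rs)$. (ii) If $r\in\mathrm{Roots}(\alpha,c)$, then for every $w\in\mathbb{N}^+$: $r{:}w\in\mathrm{Roots}(\alpha,c)$ iff $w\in\mathrm{nwleaf}(\mathrm{frag}^\alpha(c,r))$. (iii) If $s\preceq r$ and $r\in\mathrm{Roots}(\alpha,c)$, then $s\in\mathrm{Roots}(\alpha,c)$. (iv) If $(D,\beta)$ is a coalgebra and $\gamma:C\to D$ is a coalgebra morphism, then $r\in\mathrm{Roots}(\alpha,c)$ iff $r\in\mathrm{Roots}(\beta,\gamma(c))$, and for such $r$, $\mathrm{frag}^\alpha(c,r)=\mathrm{frag}^\beta(\gamma(c),r)$ and $\gamma(\mathrm{sub}^\alpha(c,r))=\mathrm{sub}^\beta(\gamma(c),r)$.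
   Context: Words are finite sequences of natural numbers; $\mathbb{N}^*$ is the set of words, $\epsilon$ the empty word, $\mathbb{N}^+$ the nonempty words; concatenation is juxtaposition. Finite sequences of elements of $\mathbb{N}^+$ are denoted $r,s$; $\mathsf{nil}$ is the empty sequence, $w{:}r$ and $r{:}w$ prepend/append $w$, $rs$ is concatenation, $\preceq$ the prefix order. A tree is a prefix-closed set of words (nodes) with a labelling; trees are finitely branching (each node $w$ has an arity $k$ with $wi$ a node iff $i<k$); leaves are maximal nodes. Fix a set $A$ of labels and $*\notin A$. A finite tree with non-wellfounded leaves is a finite tree $\iota$ labelled in $A\cup\{*\}$ whose root is not labelled $*$ and whose $*$-labelled nodes are leaves; $\mathrm{nwleaf}(\iota)$ is its set of $*$-labelled nodes; $\mathrm{NWT}$ is the set of such trees. The endofunctor $\mathcal{T}$ on Set: $\mathcal{T}(X)=\{(\iota,\mu):\iota\in\mathrm{NWT},\ \mu:\mathrm{nwleaf}(\iota)\to X\}$, $\mathcal{T}(f)(\iota,\mu)=(\iota,f\circ\mu)$. A coalgebra is $(C,\alpha)$ with $\alpha:C\to\mathcal{T}(C)$, writing $\alpha(c)=(\iota^\alpha_c,\mu^\alpha_c)$; a coalgebra morphism $\gamma:(C,\alpha)\to(D,\beta)$ is a function with $\beta\circ\gamma=\mathcal{T}(\gamma)\circ\alpha$. Root-paths: $\mathsf{nil}\in\mathrm{Roots}(\alpha,c)$; $w{:}r\in\mathrm{Roots}(\alpha,c)$ iff $w\in\mathrm{nwleaf}(\iota^\alpha_c)$ and $r\in\mathrm{Roots}(\alpha,\mu^\alpha_c(w))$.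 For $r\in\mathrm{Roots}(\alpha,c)$: subelement $\mathrm{sub}^\alpha(c,\mathsf{nil})=c$, $\mathrm{sub}^\alpha(c,w{:}r)=\mathrm{sub}^\alpha(\mu^\alpha_c(w),r)$; fragment $\mathrm{frag}^\alpha(c,\mathsf{nil})=\iota^\alpha_c$, $\mathrm{frag}^\alpha(c,w{:}r)=\mathrm{frag}^\alpha(\mu^\alpha_c(w),r)$. -}

module Defs where

open import Data.Nat using (ℕ; zero; suc)
open import Data.List using (List; []; _∷_; _++_; null)
open import Data.List.NonEmpty using (List⁺; toList)
open import Data.Maybe using (Maybe; just; nothing)
open import Data.Bool using (Bool; true; false; _∧_; T)
open import Data.Product using (Σ; _×_; _,_; proj₁; proj₂; ∃)
open import Data.Unit using (⊤)
open import Relation.Binary.PropositionalEquality using (_≡_)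

Word : Set
Word = List ℕ

Word⁺ : Set
Word⁺ = List⁺ ℕ

-- The node set is the set of
-- addresses w : Word reachable via 'subtree' (prefix-closed); node w has
-- arity = number of children, and w i is a node iff i < arity.
data Tree (L : Set) : Set where
  node : L → List (Tree L) → Tree L

mutual
  subtree : ∀ {L} → Word → Tree L → Maybe (Tree L)
  subtree []      t           = just t
  subtree (i ∷ w) (node _ ts) = subtreeIn i w ts

  subtreeIn : ∀ {L} → ℕ → Word → List (Tree L) → Maybe (Tree L)
  subtreeIn _       _ []       = nothing
  subtreeIn zero    w (t ∷ ts) = subtree w t
  subtreeIn (suc i) w (t ∷ ts) = subtreeIn i w ts

-- Labels in A ∪ {*}: 'just a' is the label a ∈ A, 'nothing' is *.
Label : Set → Set
Label A = Maybe A

rootNotStar : ∀ {A} → Tree (Label A) → Bool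
rootNotStar (node (just _) _) = true
rootNotStar (node nothing  _) = false

mutual
  starsAreLeaves : ∀ {A} → Tree (Label A) → Bool
  starsAreLeaves (node nothing  ts) = null ts
  starsAreLeaves (node (just _) ts) = allStarsAreLeaves ts

  allStarsAreLeaves : ∀ {A} → List (Tree (Label A)) → Bool
  allStarsAreLeaves []       = true
  allStarsAreLeaves (t ∷ ts) = starsAreLeaves t ∧ allStarsAreLeaves ts

NWT : Set → Set
NWT A = Σ (Tree (Label A)) (λ t → T (rootNotStar t ∧ starsAreLeaves t))

isStarNode : ∀ {A} → Word → Tree (Label A) → Bool
isStarNode w t with subtree w t
... | just (node nothing _) = true
... | _                     = false

nwleaf : ∀ {A} → NWT A → Word → Set
nwleaf ι w = T (isStarNode w (proj₁ ι))

𝒯 : Set → Set → Set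
𝒯 A X = Σ (NWT A) (λ ι → (w : Word) → nwleaf ι w → X)

𝒯map : ∀ {A X Y} → (X → Y) → 𝒯 A X → 𝒯 A Y
𝒯map f (ι , μ) = ι , (λ w p → f (μ w p))

Coalg : Set → Set → Set
Coalg A C = C → 𝒯 A C

module _ {A C : Set} (α : Coalg A C) where
  ιof : C → NWT A
  ιof c = proj₁ (α c)

  μof : (c : C) → (w : Word) → nwleaf (ιof c) w → C
  μof c = proj₂ (α c)

-- Coalgebra morphism: β ∘ γ = 𝒯(γ) ∘ α, equality of elements of 𝒯(D)
-- spelled out componentwise (trees equal; μ-maps agree pointwise on nwleaves).
IsCoalgMorphism : ∀ {A C D} → Coalg A C → Coalg A D → (C → D) → Set
IsCoalgMorphism {A} {C} {D} α β γ =
  (c : C) → Σ (proj₁ (β (γ c)) ≡ proj₁ (𝒯map γ (α c)))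
              (λ _ → (w : Word) (p : nwleaf (proj₁ (β (γ c))) w)
                       (q : nwleaf (proj₁ (𝒯map γ (α c))) w) →
                       proj₂ (β (γ c)) w p ≡ proj₂ (𝒯map γ (α c)) w q)

Roots : ∀ {A C} → Coalg A C → C → List Word⁺ → Set
Roots α c []      = ⊤
Roots α c (w ∷ r) = Σ (nwleaf (ιof α c) (toList w)) (λ p → Roots α (μof α c (toList w) p) r)

sub : ∀ {A C} (α : Coalg A C) (c : C) (r : List Word⁺) → Roots α c r → C
sub α c []      _       = c
sub α c (w ∷ r) (p , q) = sub α (μof α c (toList w) p) r q

frag : ∀ {A C} (α : Coalg A C) (c : C) (r : List Word⁺) → Roots α c r → NWT A
frag α c []      _       = ιof α c
frag α c (w ∷ r) (p , q) = frag α (μof α c (toList w) p) r q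

_⪯_ : ∀ {X : Set} → List X → List X → Set
s ⪯ r = ∃ (λ t → s ++ t ≡ r)

{-# OPTIONS --safe #-}
module Submission where

open import Defs
open import Data.Bool.Properties using (T-irrelevant)
open import Data.List using (List; []; _∷_; _++_; _∷ʳ_)
open import Data.List.NonEmpty using (toList)
open import Data.Product using (Σ; _×_; _,_; proj₁; proj₂)
open import Data.Unit using (tt)
open import Relation.Binary.PropositionalEquality using (_≡_; refl; sym; subst)

module _ {A C : Set} (α : Coalg A C) where

  Roots-++⁺ : ∀ {c} r {s} (p : Roots α c r) → Roots α (sub α c r p) s → Roots α c (r ++ s)
  Roots-++⁺ []      _        q = q
  Roots-++⁺ (_ ∷ r) (p₀ , p) q = p₀ , Roots-++⁺ r p q

  Roots-++⁻ˡ : ∀ {c} r {s} → Roots α c (r ++ s) → Roots α c r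
  Roots-++⁻ˡ []      _        = tt
  Roots-++⁻ˡ (_ ∷ r) (p₀ , p) = p₀ , Roots-++⁻ˡ r p

  Roots-++⁻ʳ : ∀ {c} r {s} (p : Roots α c r) → Roots α c (r ++ s) → Roots α (sub α c r p) s
  Roots-++⁻ʳ []      _        q        = q
  Roots-++⁻ʳ (_ ∷ r) (p₀ , p) (q₀ , q) with refl ← T-irrelevant p₀ q₀ = Roots-++⁻ʳ r p q

  frag-++ : ∀ {c} r {s} (p : Roots α c r) (q : Roots α (sub α c r p) s) →
            frag α (sub α c r p) s q ≡ frag α c (r ++ s) (Roots-++⁺ r p q)
  frag-++ []      _        _ = refl
  frag-++ (_ ∷ r) (_ , p)  q = frag-++ r p q

  sub-++ : ∀ {c} r {s} (p : Roots α c r) (q : Roots α (sub α c r p) s) →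
           sub α (sub α c r p) s q ≡ sub α c (r ++ s) (Roots-++⁺ r p q)
  sub-++ []      _        _ = refl
  sub-++ (_ ∷ r) (_ , p)  q = sub-++ r p q

  frag≡ιof-sub : ∀ {c} r (p : Roots α c r) → frag α c r p ≡ ιof α (sub α c r p)
  frag≡ιof-sub []      _       = refl
  frag≡ιof-sub (_ ∷ r) (_ , p) = frag≡ιof-sub r p

  Roots-∷ʳ⁻ : ∀ {c} r {w} (p : Roots α c r) → Roots α c (r ∷ʳ w) → nwleaf (frag α c r p) (toList w)
  Roots-∷ʳ⁻ r {w} p q =
    subst (λ ι → nwleaf ι (toList w)) (sym (frag≡ιof-sub r p)) (proj₁ (Roots-++⁻ʳ r p q))

  Roots-∷ʳ⁺ : ∀ {c} r {w} (p : Roots α c r) → nwleaf (frag α c r p) (toList w) → Roots α c (r ∷ʳ w)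
  Roots-∷ʳ⁺ r {w} p x =
    Roots-++⁺ r p (subst (λ ι → nwleaf ι (toList w)) (frag≡ιof-sub r p) x , tt)

  Roots-prefix : ∀ {c r s} → s ⪯ r → Roots α c r → Roots α c s
  Roots-prefix {s = s} (_ , refl) = Roots-++⁻ˡ s

  module _ {D : Set} (β : Coalg A D) (γ : C → D) (γ-hom : IsCoalgMorphism α β γ) where

    ιof-preserved : ∀ c → ιof β (γ c) ≡ ιof α c
    ιof-preserved c = proj₁ (γ-hom c)

    μof-preserved : ∀ c w (p : nwleaf (ιof β (γ c)) w) (q : nwleaf (ιof α c) w) →
                    μof β (γ c) w p ≡ γ (μof α c w q)
    μof-preserved c = proj₂ (γ-hom c)

    nwleaf-preserved : ∀ c w → nwleaf (ιof α c) w → nwleaf (ιof β (γ c)) w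
    nwleaf-preserved c w = subst (λ ι → nwleaf ι w) (sym (ιof-preserved c))

    nwleaf-reflected : ∀ c w → nwleaf (ιof β (γ c)) w → nwleaf (ιof α c) w
    nwleaf-reflected c w = subst (λ ι → nwleaf ι w) (ιof-preserved c)

    -- Generalising γ c to any d ≡ γ c lets the induction pass to a child of γ c
    -- that is only propositionally equal to the image of the corresponding child of c.
    Roots-preserved : ∀ {c d} r → γ c ≡ d → Roots α c r → Roots β d r
    Roots-preserved []      _    _        = tt
    Roots-preserved (w ∷ r) refl (p₀ , p) =
      q₀ , Roots-preserved r (sym (μof-preserved _ (toList w) q₀ p₀)) p
      where q₀ = nwleaf-preserved _ (toList w) p₀

    Roots-reflected : ∀ {c d} r → γ c ≡ d → Roots β d r → Roots α c r
    Roots-reflected []      _    _        = tt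
    Roots-reflected (w ∷ r) refl (q₀ , q) =
      p₀ , Roots-reflected r (sym (μof-preserved _ (toList w) q₀ p₀)) q
      where p₀ = nwleaf-reflected _ (toList w) q₀

    frag-preserved : ∀ {c d} r → γ c ≡ d → (p : Roots α c r) (q : Roots β d r) →
                     frag α c r p ≡ frag β d r q
    frag-preserved {c} []      refl _        _        = sym (ιof-preserved c)
    frag-preserved     (w ∷ r) refl (p₀ , p) (q₀ , q) =
      frag-preserved r (sym (μof-preserved _ (toList w) q₀ p₀)) p q

    sub-preserved : ∀ {c d} r → γ c ≡ d → (p : Roots α c r) (q : Roots β d r) →
                    γ (sub α c r p) ≡ sub β d r q
    sub-preserved []      refl _        _        = refl
    sub-preserved (w ∷ r) refl (p₀ , p) (q₀ , q) =
      sub-preserved r (sym (μof-preserved _ (toList w) q₀ p₀)) p q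

lemma2p6 : {A C : Set} (α : Coalg A C) (c : C) →
      ((r s : List Word⁺) (p : Roots α c r) (q : Roots α (sub α c r p) s) →
        Σ (Roots α c (r ++ s)) (λ pq →
          (frag α (sub α c r p) s q ≡ frag α c (r ++ s) pq)
          × (sub α (sub α c r p) s q ≡ sub α c (r ++ s) pq)))
    × ((r : List Word⁺) (p : Roots α c r) (w : Word⁺) →
        (Roots α c (r ∷ʳ w) → nwleaf (frag α c r p) (toList w))
        × (nwleaf (frag α c r p) (toList w) → Roots α c (r ∷ʳ w)))
    × ((r s : List Word⁺) → s ⪯ r → Roots α c r → Roots α c s)
    × ({D : Set} (β : Coalg A D) (γ : C → D) → IsCoalgMorphism α β γ →
        (r : List Word⁺) →
          (Roots α c r → Roots β (γ c) r)
        × (Roots β (γ c) r → Roots α c r)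
        × ((p : Roots α c r) (q : Roots β (γ c) r) →
            (frag α c r p ≡ frag β (γ c) r q)
            × (γ (sub α c r p) ≡ sub β (γ c) r q)))
lemma2p6 α c =
    (λ r s p q → Roots-++⁺ α r p q , frag-++ α r p q , sub-++ α r p q)
  , (λ r p w → Roots-∷ʳ⁻ α r p , Roots-∷ʳ⁺ α r p)
  , (λ r s → Roots-prefix α)
  , λ β γ γ-hom r →
        Roots-preserved α β γ γ-hom r refl
      , Roots-reflected α β γ γ-hom r refl
      , λ p q → frag-preserved α β γ γ-hom r refl p q , sub-preserved α β γ γ-hom r refl p q
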